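{- Let $C=C_1C_2\cdots C_m$ be a nonincreasing word of integers ($C_1\ge C_2\ge\cdots\ge C_m$, $m\ge 1$), written by grouping equal letters as $C=M_1^{m_1}M_2^{m_2}\cdots M_t^{m_t}$ with $m_i>0$ and $M_1>M_2>\cdots>M_t$. Let $\mathbb{B}_C$ and $|S_C(D)|$ be as defined in the context. Then \[ x_{C_1}x_{C_2}\cdots x_{C_m}=\sum_{D\in \mathbb{B}_C}(-1)^{|S_C(D)|}\,\overleftarrow{\mathfrak{F}}(D), \] as an identity of formal power series in the variables $\{x_i : i\in\mathbb{Z}\}$.
   Context: For a nonincreasing word $D=D_1\cdots D_m$ of integers, the back stable slide $\overleftarrow{\mathfrak{F}}(D)$ is the formal power series \[ \overleftarrow{\mathfrak{F}}(D)=\sum x_{i_1}x_{i_2}\cdots x_{i_m}, \] summed over all integer sequences $i_1\ge i_2\ge\cdots\ge i_m$ (of arbitrary sign) such that $i_k\le D_k$ for all $k$, and $i_k>i_{k+1}$ whenever $D_k>D_{k+1}$. For $C=M_1^{m_1}\cdots M_t^{m_t}$ as in the claim and $i\in\{1,\dots,t\}$, set $x_0=M_i$ and let $B_i$ be the set of nonincreasing words $x_1x_2\cdots x_{m_i}$ of integers such that $x_{j+1}\in\{x_j,x_j-1\}$ for $0\le j\le m_i-1$, and $x_{m_i}>M_{i+1}$ (this last condition is vacuous when $i=t$). Let $\mathbb{B}_C$ be the set of concatenations $X^1X^2\cdots X^t$ with $X^i\in B_i$ for each $i$. For $D=X^1\cdots X^t\in\mathbb{B}_C$ with $X^i=x^{(i)}_1\cdots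 x^{(i)}_{m_i}$ (and $x^{(i)}_0=M_i$), $S_C(D)$ is the set of all positions $j$ (within each block $i$, $0\le j\le m_i-1$) where $x^{(i)}_{j+1}=x^{(i)}_j-1$, and $|S_C(D)|$ is the total number of such positions over all blocks. For example, for $C=442$, $\mathbb{B}_C=\{442,332,432,441,331,431\}$. -}

module Defs where

open import Data.Integer as ℤ using (ℤ; +_; _-_; -_; _+_; _*_; _^_; _≤?_; _<?_)
open import Data.Nat as ℕ using (ℕ; zero; suc)
open import Data.List using (List; []; _∷_; [_]; _++_; map; concatMap; filterᵇ; last; foldr; replicate)
open import Data.List.Properties using (≡-dec)
open import Data.List.Relation.Unary.Linked using (Linked)
open import Data.Maybe using (Maybe; just; nothing)
open import Data.Product using (Σ; _×_; _,_; proj₁; proj₂)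
open import Data.Bool using (Bool; true; false; if_then_else_; _∧_)
open import Relation.Nullary.Decidable using (⌊_⌋)
open import Relation.Binary.PropositionalEquality using (_≡_)

Nonincreasing : List ℤ → Set
Nonincreasing = Linked ℤ._≥_

-- A monomial (of any finite degree) in the variables {x_i : i ∈ ℤ} is encoded
-- by its index word written in nonincreasing order:
-- x_{i₁}⋯x_{i_m} with i₁ ≥ ⋯ ≥ i_m  ↦  i₁ ∷ ⋯ ∷ i_m ∷ [].
-- This is a bijection between monomials and nonincreasing integer words.
Monomial : Set
Monomial = Σ (List ℤ) Nonincreasing

Series : Set
Series = Monomial → ℤ

_≈ˢ_ : Series → Series → Set
f ≈ˢ g = ∀ μ → f μ ≡ g μ

monomialSeries : List ℤ → Series
monomialSeries C (w , _) = if ⌊ ≡-dec ℤ._≟_ w C ⌋ then + 1 else + 0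

-- Conditions of the back stable slide: for the index word i₁ ≥ ⋯ ≥ i_m of a
-- monomial (nonincreasing by construction of Monomial), require the same length
-- as D, i_k ≤ D_k, and i_k > i_{k+1} whenever D_k > D_{k+1}.
strictOK : ℤ → List ℤ → ℤ → List ℤ → Bool
strictOK d (d' ∷ _) i (i' ∷ _) = if ⌊ d' <? d ⌋ then ⌊ i' <? i ⌋ else true
strictOK _ _ _ _ = true

slideOK : List ℤ → List ℤ → Bool
slideOK [] [] = true
slideOK (d ∷ ds) (i ∷ is) = ⌊ i ≤? d ⌋ ∧ strictOK d ds i is ∧ slideOK ds is
slideOK _ _ = false

-- The back stable slide F←(D): the sum of x_{i₁}⋯x_{i_m} over admissible
-- sequences.  Each monomial arises from at most one sequence (its sorted index
-- word), so its coefficient is 1 if that word is admissible and 0 otherwise.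
backStableSlide : List ℤ → Series
backStableSlide D (w , _) = if slideOK D w then + 1 else + 0

-- All words x₁⋯x_n with x_{j+1} ∈ {x_j, x_j - 1} (x₀ given), each paired with
-- the number of positions j where x_{j+1} = x_j - 1.
paths : ℤ → ℕ → List (List ℤ × ℕ)
paths x₀ zero = [ ([] , 0) ]
paths x₀ (suc n) =
  map (λ p → (x₀ ∷ proj₁ p , proj₂ p)) (paths x₀ n)
  ++ map (λ p → ((x₀ - + 1) ∷ proj₁ p , suc (proj₂ p))) (paths (x₀ - + 1) n)

lastAbove : Maybe ℤ → List ℤ → Bool
lastAbove nothing _ = true
lastAbove (just b) w with last w
... | just x = ⌊ b <? x ⌋
... | nothing = false

blockB : ℤ → ℕ → Maybe ℤ → List (List ℤ × ℕ)
blockB M k next = filterᵇ (λ p → lastAbove next (proj₁ p)) (paths M k)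

nextLetter : List (ℤ × ℕ) → Maybe ℤ
nextLetter [] = nothing
nextLetter ((M , _) ∷ _) = just M

-- 𝔹_C: all concatenations X¹⋯X^t with X^i ∈ B_i, paired with |S_C(D)|.
-- (Distinct step choices give distinct words, so this list has no repetitions.)
BC : List (ℤ × ℕ) → List (List ℤ × ℕ)
BC [] = [ ([] , 0) ]
BC ((M , k) ∷ rest) =
  concatMap (λ p → map (λ q → (proj₁ p ++ proj₁ q , proj₂ p ℕ.+ proj₂ q)) (BC rest))
            (blockB M k (nextLetter rest))

sumℤ : List ℤ → ℤ
sumℤ = foldr _+_ (+ 0)

signedSlideSum : List (ℤ × ℕ) → Series
signedSlideSum bs μ = sumℤ (map (λ p → ((- + 1) ^ proj₂ p) * backStableSlide (proj₁ p) μ) (BC bs))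

expand : List (ℤ × ℕ) → List ℤ
expand = concatMap (λ b → replicate (proj₂ b) (proj₁ b))

-- Fix a monomial w; its coefficient on the right is the signed number of D ∈ 𝔹_C whose slide
-- contains w.  For one block M^n, splitting on the first step of the path (M or M - 1) gives
-- [w₁ ≤ M] - [w₁ ≤ M - 1] = [w₁ = M]; recursively, a descent of D forces a strict descent of
-- the nonincreasing word w, so the terms cancel unless each letter of w equals the previous
-- one, and the block contributes [w = M^n].  For several blocks, the last letter of every
-- X ∈ B₁ exceeds M₂, which bounds the first letter of every word of the later blocks, so the
-- slide condition for X Y splits into one for X on the first m₁ letters of w, a strict descent
-- of w after them, and one for Y on the remaining letters; induction on the number of blocks
-- then yields [w = M₁^{m₁} ⋯ M_t^{m_t}].

module Submission where

open import Defs
open import Data.Integer using (ℤ; _>_)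
open import Data.Nat using (ℕ)
open import Data.List using (List; [])
open import Data.List.Relation.Unary.All using (All)
open import Data.List.Relation.Unary.Linked using (Linked)
open import Data.Product using (_×_; proj₁; proj₂)
open import Relation.Binary.PropositionalEquality using (_≡_; _≢_)
import Data.Nat as N

open import Data.Bool using (Bool; true; false; T; _∧_; if_then_else_)
open import Data.Bool.Properties using (∧-assoc; ∧-comm; ∧-zeroʳ; T-∧; T-≡)
open import Data.Integer using (+_; -_; _+_; _-_; _*_; _^_; _≤_; _<_; _≤?_; _<?_; _≟_)
import Data.Integer.Properties as ℤ
open import Data.List using (_∷_; [_]; _++_; map; concat; filterᵇ; head; last; take; drop; length; replicate)
open import Data.List.Properties using (≡-dec; map-∘; map-cong-local; take++drop≡id; length-replicate)
import Data.List.Relation.Unary.All as All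
open import Data.List.Relation.Unary.All using ([]; _∷_)
open import Data.List.Relation.Unary.All.Properties using (++⁺; map⁺; concat⁺; filter⁺; all-filter)
import Data.List.Relation.Unary.Linked as Linked
open import Data.List.Relation.Unary.Linked using ([]; [-]; _∷_)
open import Data.Maybe using (just; nothing)
open import Data.Maybe.Relation.Unary.Any using (Any; just)
open import Data.Nat using (zero; suc)
open import Data.Product using (_,_)
open import Data.Unit using (tt)
open import Function.Bundles using (Equivalence)
open import Relation.Binary.Definitions using (DecidableEquality)
open import Relation.Binary.PropositionalEquality using (refl; sym; trans; cong; cong₂; subst; module ≡-Reasoning)
open import Relation.Nullary using (Dec; ¬_)
open import Relation.Nullary.Decidable using (⌊_⌋; yes; no; isYes≗does; dec-true; dec-false; toWitness; fromWitness)

open ≡-Reasoning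

infix 4 _≟ʷ_
_≟ʷ_ : DecidableEquality (List ℤ)
_≟ʷ_ = ≡-dec _≟_

χ : Bool → ℤ
χ b = if b then + 1 else + 0

onlyIf : Bool → ℤ → ℤ
onlyIf c z = if c then z else + 0

signedTerm : (List ℤ → Bool) → List ℤ × ℕ → ℤ
signedTerm f p = ((- + 1) ^ proj₂ p) * χ (f (proj₁ p))

signedSum : List (List ℤ × ℕ) → (List ℤ → Bool) → ℤ
signedSum L f = sumℤ (map (signedTerm f) L)

Positive : List (ℤ × ℕ) → Set
Positive = All (λ b → 0 N.< proj₂ b)

Decreasing : List (ℤ × ℕ) → Set
Decreasing = Linked (λ a b → proj₁ a > proj₁ b)

SlideExpansion : List (ℤ × ℕ) → Set
SlideExpansion bs = ∀ w → Nonincreasing w → signedSum (BC bs) (λ D → slideOK D w) ≡ χ ⌊ w ≟ʷ expand bs ⌋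

⌊⌋-true : ∀ {A : Set} (a? : Dec A) → A → ⌊ a? ⌋ ≡ true
⌊⌋-true a? a = trans (isYes≗does a?) (dec-true a? a)

⌊⌋-false : ∀ {A : Set} (a? : Dec A) → ¬ A → ⌊ a? ⌋ ≡ false
⌊⌋-false a? ¬a = trans (isYes≗does a?) (dec-false a? ¬a)

∧-T : ∀ a b → T (a ∧ b) → T a × T b
∧-T a b = Equivalence.to (T-∧ {a} {b})

∧-absorbˡ : ∀ a b → (T b → T a) → a ∧ b ≡ b
∧-absorbˡ true  b _ = refl
∧-absorbˡ false true b⇒a with b⇒a tt
... | ()
∧-absorbˡ false false _ = refl

χ-∧ : ∀ c b → χ (c ∧ b) ≡ onlyIf c (χ b)
χ-∧ true  b = refl
χ-∧ false b = refl

≟ʷ-∷ : ∀ a b u v → ⌊ (a ∷ u) ≟ʷ (b ∷ v) ⌋ ≡ ⌊ a ≟ b ⌋ ∧ ⌊ u ≟ʷ v ⌋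
≟ʷ-∷ a b u v with a ≟ b | u ≟ʷ v
... | yes _ | yes _ = refl
... | yes _ | no _  = refl
... | no _  | _     = refl

i-1<i : ∀ i → i - + 1 < i
i-1<i i = subst (_< i) (ℤ.+-comm (- + 1) i) (ℤ.i≤pred[j]⇒i<j ℤ.≤-refl)

i<j⇒i≤j-1 : ∀ {i j} → i < j → i ≤ j - + 1
i<j⇒i≤j-1 {i} {j} i<j = subst (i ≤_) (ℤ.+-comm (- + 1) j) (ℤ.i<j⇒i≤pred[j] i<j)

signedSum-singleton : ∀ X f → signedSum [ (X , 0) ] f ≡ χ (f X)
signedSum-singleton X f = trans (ℤ.+-identityʳ _) (ℤ.*-identityˡ _)

signedSum-++ : ∀ L L′ f → signedSum (L ++ L′) f ≡ signedSum L f + signedSum L′ f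
signedSum-++ []      L′ f = sym (ℤ.+-identityˡ _)
signedSum-++ (p ∷ L) L′ f =
  trans (cong (λ z → signedTerm f p + z) (signedSum-++ L L′ f)) (sym (ℤ.+-assoc (signedTerm f p) _ _))

signedSum-congᴬ : ∀ {L f g} → All (λ p → f (proj₁ p) ≡ g (proj₁ p)) L → signedSum L f ≡ signedSum L g
signedSum-congᴬ eqs =
  cong sumℤ (map-cong-local (All.map (λ {p} e → cong (λ b → ((- + 1) ^ proj₂ p) * χ b) e) eqs))

signedSum-cong : ∀ {f g} → (∀ X → f X ≡ g X) → ∀ L → signedSum L f ≡ signedSum L g
signedSum-cong f≗g L = signedSum-congᴬ (All.universal (λ p → f≗g (proj₁ p)) L)

signedSum-false : ∀ {f} → (∀ X → f X ≡ false) → ∀ L → signedSum L f ≡ + 0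
signedSum-false f≗false []            = refl
signedSum-false f≗false ((X , s) ∷ L) rewrite f≗false X =
  cong₂ _+_ (ℤ.*-zeroʳ ((- + 1) ^ s)) (signedSum-false f≗false L)

signedSum-guardˡ : ∀ c L f → signedSum L (λ X → c ∧ f X) ≡ onlyIf c (signedSum L f)
signedSum-guardˡ true  L f = refl
signedSum-guardˡ false L f = signedSum-false (λ _ → refl) L

signedSum-guardʳ : ∀ c L f → signedSum L (λ X → f X ∧ c) ≡ onlyIf c (signedSum L f)
signedSum-guardʳ c L f = trans (signedSum-cong (λ X → ∧-comm (f X) c) L) (signedSum-guardˡ c L f)

signedSum-filterᵇ : ∀ (q : List ℤ → Bool) L f →
  signedSum (filterᵇ (λ p → q (proj₁ p)) L) f ≡ signedSum L (λ X → q X ∧ f X)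
signedSum-filterᵇ q []            f = refl
signedSum-filterᵇ q ((X , s) ∷ L) f with q X
... | true  = cong (λ z → signedTerm f (X , s) + z) (signedSum-filterᵇ q L f)
... | false = begin
    signedSum (filterᵇ (λ p → q (proj₁ p)) L) f
  ≡⟨ signedSum-filterᵇ q L f ⟩
    signedSum L (λ X → q X ∧ f X)
  ≡⟨ sym (ℤ.+-identityˡ _) ⟩
    + 0 + signedSum L (λ X → q X ∧ f X)
  ≡⟨ cong₂ _+_ (sym (ℤ.*-zeroʳ ((- + 1) ^ s))) refl ⟩
    ((- + 1) ^ s) * + 0 + signedSum L (λ X → q X ∧ f X)
  ∎

signedSum-map-∷ : ∀ y L f → signedSum (map (λ p → (y ∷ proj₁ p , proj₂ p)) L) f ≡ signedSum L (λ X → f (y ∷ X))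
signedSum-map-∷ y []      f = refl
signedSum-map-∷ y (p ∷ L) f = cong (λ z → signedTerm (λ X → f (y ∷ X)) p + z) (signedSum-map-∷ y L f)

signedSum-map-∷-flip : ∀ y L f →
  signedSum (map (λ p → (y ∷ proj₁ p , suc (proj₂ p))) L) f ≡ - signedSum L (λ X → f (y ∷ X))
signedSum-map-∷-flip y []            f = refl
signedSum-map-∷-flip y ((X , s) ∷ L) f = begin
    ((- + 1) ^ suc s) * χ (f (y ∷ X)) + signedSum (map (λ p → (y ∷ proj₁ p , suc (proj₂ p))) L) f
  ≡⟨ cong₂ _+_ (trans (ℤ.*-assoc (- + 1) ((- + 1) ^ s) _) (ℤ.-1*i≡-i t)) (signedSum-map-∷-flip y L f) ⟩
    - t + - signedSum L (λ X → f (y ∷ X))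
  ≡⟨ sym (ℤ.neg-distrib-+ t _) ⟩
    - (t + signedSum L (λ X → f (y ∷ X)))
  ∎
  where t = ((- + 1) ^ s) * χ (f (y ∷ X))

signedSum-paths-suc : ∀ y n f → signedSum (paths y (suc n)) f
  ≡ signedSum (paths y n) (λ X → f (y ∷ X)) - signedSum (paths (y - + 1) n) (λ X → f (y - + 1 ∷ X))
signedSum-paths-suc y n f =
  trans (signedSum-++ (map (λ p → (y ∷ proj₁ p , proj₂ p)) (paths y n)) _ f)
        (cong₂ _+_ (signedSum-map-∷ y (paths y n) f) (signedSum-map-∷-flip (y - + 1) (paths (y - + 1) n) f))

signedSum-map-++ : ∀ X s L f → signedSum (map (λ q → (X ++ proj₁ q , s N.+ proj₂ q)) L) f
  ≡ ((- + 1) ^ s) * signedSum L (λ Y → f (X ++ Y))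
signedSum-map-++ X s []            f = sym (ℤ.*-zeroʳ ((- + 1) ^ s))
signedSum-map-++ X s ((Y , t) ∷ L) f = begin
    ((- + 1) ^ (s N.+ t)) * χ (f (X ++ Y)) + signedSum (map (λ q → (X ++ proj₁ q , s N.+ proj₂ q)) L) f
  ≡⟨ cong₂ _+_ (trans (cong (_* χ (f (X ++ Y))) (ℤ.^-distribˡ-+-* (- + 1) s t))
                      (ℤ.*-assoc ((- + 1) ^ s) ((- + 1) ^ t) (χ (f (X ++ Y)))))
               (signedSum-map-++ X s L f) ⟩
    ((- + 1) ^ s) * (((- + 1) ^ t) * χ (f (X ++ Y))) + ((- + 1) ^ s) * signedSum L (λ Y → f (X ++ Y))
  ≡⟨ sym (ℤ.*-distribˡ-+ ((- + 1) ^ s) _ (signedSum L (λ Y → f (X ++ Y)))) ⟩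
    ((- + 1) ^ s) * signedSum ((Y , t) ∷ L) (λ Y → f (X ++ Y))
  ∎

signedSum-concat : ∀ Ls f → signedSum (concat Ls) f ≡ sumℤ (map (λ L → signedSum L f) Ls)
signedSum-concat []       f = refl
signedSum-concat (L ∷ Ls) f =
  trans (signedSum-++ L (concat Ls) f) (cong (λ z → signedSum L f + z) (signedSum-concat Ls f))

signedSum-BC-∷ : ∀ M k rest f g →
  All (λ p → signedSum (BC rest) (λ Y → f (proj₁ p ++ Y)) ≡ χ (g (proj₁ p))) (blockB M k (nextLetter rest)) →
  signedSum (BC ((M , k) ∷ rest)) f ≡ signedSum (blockB M k (nextLetter rest)) g
signedSum-BC-∷ M k rest f g inner = begin
    signedSum (BC ((M , k) ∷ rest)) f
  ≡⟨ signedSum-concat (map blockWith B₁) f ⟩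
    sumℤ (map (λ L → signedSum L f) (map blockWith B₁))
  ≡⟨ cong sumℤ (sym (map-∘ B₁)) ⟩
    sumℤ (map (λ p → signedSum (blockWith p) f) B₁)
  ≡⟨ cong sumℤ (map-cong-local (All.map (λ {p} e → trans (signedSum-map-++ (proj₁ p) (proj₂ p) (BC rest) f)
                                                            (cong (((- + 1) ^ proj₂ p) *_) e)) inner)) ⟩
    signedSum B₁ g
  ∎
  where
  B₁ = blockB M k (nextLetter rest)
  blockWith : List ℤ × ℕ → List (List ℤ × ℕ)
  blockWith p = map (λ q → (proj₁ p ++ proj₁ q , proj₂ p N.+ proj₂ q)) (BC rest)

-- A single block

slideOK-[] : ∀ w → slideOK [] w ≡ ⌊ w ≟ʷ [] ⌋
slideOK-[] []      = refl
slideOK-[] (_ ∷ _) = refl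

slideOK-∷⁻ : ∀ x X a u → T (slideOK (x ∷ X) (a ∷ u)) → a ≤ x × T (slideOK X u)
slideOK-∷⁻ x X a u ok with ∧-T ⌊ a ≤? x ⌋ _ ok
... | a≤x , rest = toWitness a≤x , proj₂ (∧-T (strictOK x X a u) _ rest)

slideOK-stay : ∀ y X a w → slideOK (y ∷ y ∷ X) (a ∷ w) ≡ ⌊ a ≤? y ⌋ ∧ slideOK (y ∷ X) w
slideOK-stay y X a []      = refl
slideOK-stay y X a (_ ∷ _) rewrite ⌊⌋-false (y <? y) (ℤ.<-irrefl refl) = refl

slideOK-descend : ∀ y X a w →
  slideOK (y ∷ y - + 1 ∷ X) (a ∷ w) ≡ ⌊ a ≤? y ⌋ ∧ lastAbove (head w) [ a ] ∧ slideOK (y - + 1 ∷ X) w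
slideOK-descend y X a []      = refl
slideOK-descend y X a (_ ∷ _) rewrite ⌊⌋-true (y - + 1 <? y) (i-1<i y) = refl

-- When b < a both terms equal χ R and cancel; otherwise b = a and only the first survives.
telescope-descent : ∀ y a b u n → b ≤ a →
  let R = ⌊ u ≟ʷ replicate n b ⌋ in
  onlyIf ⌊ a ≤? y ⌋ (χ (⌊ b ≤? y ⌋ ∧ R)) - onlyIf ⌊ a ≤? y ⌋ (onlyIf ⌊ b <? a ⌋ (χ (⌊ b ≤? y - + 1 ⌋ ∧ R)))
  ≡ χ (⌊ a ≤? y ⌋ ∧ ⌊ b ∷ u ≟ʷ a ∷ replicate n a ⌋)
telescope-descent y a b u n b≤a with a ≤? y
... | no _    = refl
... | yes a≤y with b <? a
...   | yes b<a
  rewrite ⌊⌋-true (b ≤? y) (ℤ.≤-trans b≤a a≤y) | ⌊⌋-true (b ≤? y - + 1) (i<j⇒i≤j-1 (ℤ.<-≤-trans b<a a≤y))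
        | ≟ʷ-∷ b a u (replicate n a) | ⌊⌋-false (b ≟ a) (ℤ.<⇒≢ b<a)
  = ℤ.+-inverseʳ (χ ⌊ u ≟ʷ replicate n b ⌋)
...   | no b≮a with ℤ.≤-antisym b≤a (ℤ.≮⇒≥ b≮a)
...     | refl rewrite ⌊⌋-true (b ≤? y) a≤y | ≟ʷ-∷ b b u (replicate n b) | ⌊⌋-true (b ≟ b) refl
  = ℤ.+-identityʳ (χ ⌊ u ≟ʷ replicate n b ⌋)

signedSum-slideOK-∷-paths : ∀ y n a u → Nonincreasing (a ∷ u) →
  signedSum (paths y n) (λ X → slideOK (y ∷ X) (a ∷ u)) ≡ χ (⌊ a ≤? y ⌋ ∧ ⌊ u ≟ʷ replicate n a ⌋)
signedSum-slideOK-∷-paths y zero a u _ =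
  trans (signedSum-singleton [] (λ X → slideOK (y ∷ X) (a ∷ u))) (cong (λ b → χ (⌊ a ≤? y ⌋ ∧ b)) (slideOK-[] u))
signedSum-slideOK-∷-paths y (suc n) a [] _ = begin
    signedSum (paths y (suc n)) (λ X → slideOK (y ∷ X) [ a ])
  ≡⟨ signedSum-paths-suc y n _ ⟩
    signedSum (paths y n) (λ X → ⌊ a ≤? y ⌋ ∧ false) - signedSum (paths (y - + 1) n) (λ X → ⌊ a ≤? y ⌋ ∧ false)
  ≡⟨ cong₂ _-_ (signedSum-false (λ _ → ∧-zeroʳ _) (paths y n)) (signedSum-false (λ _ → ∧-zeroʳ _) (paths (y - + 1) n)) ⟩
    + 0
  ≡⟨ cong χ (sym (∧-zeroʳ ⌊ a ≤? y ⌋)) ⟩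
    χ (⌊ a ≤? y ⌋ ∧ false)
  ∎
signedSum-slideOK-∷-paths y (suc n) a (b ∷ u) ni@(b≤a ∷ ni′) = begin
    signedSum (paths y (suc n)) (λ X → slideOK (y ∷ X) (a ∷ b ∷ u))
  ≡⟨ signedSum-paths-suc y n _ ⟩
    signedSum (paths y n) (λ X → slideOK (y ∷ y ∷ X) (a ∷ b ∷ u))
      - signedSum (paths y′ n) (λ X → slideOK (y ∷ y′ ∷ X) (a ∷ b ∷ u))
  ≡⟨ cong₂ _-_ (signedSum-cong (λ X → slideOK-stay y X a (b ∷ u)) (paths y n))
               (signedSum-cong (λ X → slideOK-descend y X a (b ∷ u)) (paths y′ n)) ⟩
    signedSum (paths y n) (λ X → ⌊ a ≤? y ⌋ ∧ slideOK (y ∷ X) (b ∷ u))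
      - signedSum (paths y′ n) (λ X → ⌊ a ≤? y ⌋ ∧ ⌊ b <? a ⌋ ∧ slideOK (y′ ∷ X) (b ∷ u))
  ≡⟨ cong₂ _-_ (signedSum-guardˡ ⌊ a ≤? y ⌋ (paths y n) _)
               (trans (signedSum-guardˡ ⌊ a ≤? y ⌋ (paths y′ n) _)
                      (cong (onlyIf ⌊ a ≤? y ⌋) (signedSum-guardˡ ⌊ b <? a ⌋ (paths y′ n) _))) ⟩
    onlyIf ⌊ a ≤? y ⌋ (signedSum (paths y n) (λ X → slideOK (y ∷ X) (b ∷ u)))
      - onlyIf ⌊ a ≤? y ⌋ (onlyIf ⌊ b <? a ⌋ (signedSum (paths y′ n) (λ X → slideOK (y′ ∷ X) (b ∷ u))))
  ≡⟨ cong₂ (λ s t → onlyIf ⌊ a ≤? y ⌋ s - onlyIf ⌊ a ≤? y ⌋ (onlyIf ⌊ b <? a ⌋ t))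
           (signedSum-slideOK-∷-paths y n b u ni′) (signedSum-slideOK-∷-paths y′ n b u ni′) ⟩
    onlyIf ⌊ a ≤? y ⌋ (χ (⌊ b ≤? y ⌋ ∧ R)) - onlyIf ⌊ a ≤? y ⌋ (onlyIf ⌊ b <? a ⌋ (χ (⌊ b ≤? y′ ⌋ ∧ R)))
  ≡⟨ telescope-descent y a b u n b≤a ⟩
    χ (⌊ a ≤? y ⌋ ∧ ⌊ b ∷ u ≟ʷ a ∷ replicate n a ⌋)
  ∎
  where
  y′ = y - + 1
  R = ⌊ u ≟ʷ replicate n b ⌋

telescope-pred : ∀ M a R →
  χ (⌊ a ≤? M ⌋ ∧ R) - χ (⌊ a ≤? M - + 1 ⌋ ∧ R) ≡ χ (⌊ a ≟ M ⌋ ∧ R)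
telescope-pred M a R with a ≤? M
... | no a≰M rewrite ⌊⌋-false (a ≤? M - + 1) (λ a≤M-1 → a≰M (ℤ.≤-trans a≤M-1 (ℤ.<⇒≤ (i-1<i M))))
                   | ⌊⌋-false (a ≟ M) (λ { refl → a≰M ℤ.≤-refl }) = refl
... | yes a≤M with a ≤? M - + 1
...   | yes a≤M-1 rewrite ⌊⌋-false (a ≟ M) (ℤ.<⇒≢ (ℤ.≤-<-trans a≤M-1 (i-1<i M))) = ℤ.+-inverseʳ (χ R)
...   | no a≰M-1 with ℤ.≤-antisym a≤M (ℤ.≮⇒≥ (λ a<M → a≰M-1 (i<j⇒i≤j-1 a<M)))
...     | refl rewrite ⌊⌋-true (a ≟ a) refl = ℤ.+-identityʳ (χ R)

signedSum-slideOK-paths : ∀ M n w → Nonincreasing w →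
  signedSum (paths M n) (λ X → slideOK X w) ≡ χ ⌊ w ≟ʷ replicate n M ⌋
signedSum-slideOK-paths M zero w _ =
  trans (signedSum-singleton [] (λ X → slideOK X w)) (cong χ (slideOK-[] w))
signedSum-slideOK-paths M (suc n) [] _ =
  trans (signedSum-paths-suc M n (λ X → slideOK X []))
        (cong₂ _-_ (signedSum-false (λ _ → refl) (paths M n)) (signedSum-false (λ _ → refl) (paths (M - + 1) n)))
signedSum-slideOK-paths M (suc n) (a ∷ u) ni = begin
    signedSum (paths M (suc n)) (λ X → slideOK X (a ∷ u))
  ≡⟨ signedSum-paths-suc M n _ ⟩
    signedSum (paths M n) (λ X → slideOK (M ∷ X) (a ∷ u))
      - signedSum (paths (M - + 1) n) (λ X → slideOK (M - + 1 ∷ X) (a ∷ u))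
  ≡⟨ cong₂ _-_ (signedSum-slideOK-∷-paths M n a u ni) (signedSum-slideOK-∷-paths (M - + 1) n a u ni) ⟩
    χ (⌊ a ≤? M ⌋ ∧ R) - χ (⌊ a ≤? M - + 1 ⌋ ∧ R)
  ≡⟨ telescope-pred M a R ⟩
    χ (⌊ a ≟ M ⌋ ∧ R)
  ≡⟨ cong χ (same-head (a ≟ M)) ⟩
    χ (⌊ a ≟ M ⌋ ∧ ⌊ u ≟ʷ replicate n M ⌋)
  ≡⟨ cong χ (sym (≟ʷ-∷ a M u (replicate n M))) ⟩
    χ ⌊ a ∷ u ≟ʷ M ∷ replicate n M ⌋
  ∎
  where
  R = ⌊ u ≟ʷ replicate n a ⌋
  same-head : (a≟M : Dec (a ≡ M)) → ⌊ a≟M ⌋ ∧ R ≡ ⌊ a≟M ⌋ ∧ ⌊ u ≟ʷ replicate n M ⌋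
  same-head (yes refl) = refl
  same-head (no _)     = refl

-- Splitting a slide at a block boundary

lastAbove-∷∷ : ∀ m x x′ X → lastAbove m (x ∷ x′ ∷ X) ≡ lastAbove m (x′ ∷ X)
lastAbove-∷∷ nothing  x x′ X = refl
lastAbove-∷∷ (just b) x x′ X with last (x′ ∷ X)
... | just _  = refl
... | nothing = refl

lastAbove-≤ : ∀ {b c} X → b ≤ c → T (lastAbove (just c) X) → T (lastAbove (just b) X)
lastAbove-≤ (x ∷ [])     b≤c above = fromWitness (ℤ.≤-<-trans b≤c (toWitness above))
lastAbove-≤ {b} {c} (x ∷ x′ ∷ X) b≤c above = subst T (sym (lastAbove-∷∷ (just b) x x′ X))
  (lastAbove-≤ (x′ ∷ X) b≤c (subst T (lastAbove-∷∷ (just c) x x′ X) above))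

lastAbove-replicate : ∀ k {b M} → b < M → T (lastAbove (just b) (replicate (suc k) M))
lastAbove-replicate zero    b<M = fromWitness b<M
lastAbove-replicate (suc k) {b} {M} b<M =
  subst T (sym (lastAbove-∷∷ (just b) M M (replicate k M))) (lastAbove-replicate k b<M)

lastAbove-slideOK : ∀ m X u → T (slideOK X u) → T (lastAbove m u) → T (lastAbove m X)
lastAbove-slideOK nothing  X u _ _ = tt
lastAbove-slideOK (just b) (x ∷ []) (a ∷ []) ok above =
  fromWitness (ℤ.<-≤-trans (toWitness above) (proj₁ (slideOK-∷⁻ x [] a [] ok)))
lastAbove-slideOK (just b) (x ∷ x′ ∷ X) (a ∷ a′ ∷ u) ok above =
  subst T (sym (lastAbove-∷∷ (just b) x x′ X))
    (lastAbove-slideOK (just b) (x′ ∷ X) (a′ ∷ u) (proj₂ (slideOK-∷⁻ x (x′ ∷ X) a (a′ ∷ u) ok))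
                       (subst T (lastAbove-∷∷ (just b) a a′ u) above))
lastAbove-slideOK (just b) []           []          _  ()
lastAbove-slideOK (just b) []           (_ ∷ _)     () _
lastAbove-slideOK (just b) (_ ∷ _)      []          () _
lastAbove-slideOK (just b) (x ∷ [])     (a ∷ a′ ∷ u) ok _ with () ← proj₂ (slideOK-∷⁻ x [] a (a′ ∷ u) ok)
lastAbove-slideOK (just b) (x ∷ x′ ∷ X) (a ∷ [])    ok _ with () ← proj₂ (slideOK-∷⁻ x (x′ ∷ X) a [] ok)

-- lastAbove (head v) u says that the last letter of u exceeds the first letter of v, if any.
slideOK-++ : ∀ X Y w → T (lastAbove (head Y) X) →
  let u = take (length X) w ; v = drop (length X) w in
  slideOK (X ++ Y) w ≡ (slideOK X u ∧ lastAbove (head v) u) ∧ slideOK Y v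
slideOK-++ []           []      []      _ = refl
slideOK-++ []           []      (_ ∷ _) _ = refl
slideOK-++ []           (_ ∷ _) _       ()
slideOK-++ (x ∷ [])     Y       []      _ = refl
slideOK-++ (x ∷ [])     []      (a ∷ [])     _ with a ≤? x
... | yes _ = refl
... | no _  = refl
slideOK-++ (x ∷ [])     []      (a ∷ _ ∷ _)  _ = trans (∧-zeroʳ _) (sym (∧-zeroʳ _))
slideOK-++ (x ∷ [])     (y ∷ Y) (a ∷ [])     _ with a ≤? x
... | yes _ = refl
... | no _  = refl
slideOK-++ (x ∷ [])     (y ∷ Y) (a ∷ b ∷ w)  y<x rewrite Equivalence.to T-≡ y<x with a ≤? x
... | yes _ = refl
... | no _  = refl
slideOK-++ (x ∷ x′ ∷ X) Y       []           _ = refl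
slideOK-++ (x ∷ x′ ∷ X) Y       (a ∷ [])     _ with a ≤? x
... | yes _ = refl
... | no _  = refl
slideOK-++ (x ∷ x′ ∷ X) Y       (a ∷ b ∷ w)  above
  rewrite slideOK-++ (x′ ∷ X) Y (b ∷ w) (subst T (lastAbove-∷∷ (head Y) x x′ X) above)
        | lastAbove-∷∷ (head (drop (length X) w)) a b (take (length X) w)
  = reassoc ⌊ a ≤? x ⌋ (strictOK x (x′ ∷ X) a (b ∷ take (length X) w)) _ _ _
  where
  reassoc : ∀ c s p j q → c ∧ s ∧ (p ∧ j) ∧ q ≡ ((c ∧ s ∧ p) ∧ j) ∧ q
  reassoc false _     _ _ _ = refl
  reassoc true  false _ _ _ = refl
  reassoc true  true  _ _ _ = refl

nonincreasing-take : ∀ n {w} → Nonincreasing w → Nonincreasing (take n w)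
nonincreasing-take zero                  _            = []
nonincreasing-take (suc n)       {[]}    _            = []
nonincreasing-take (suc zero)    {_ ∷ _} _            = [-]
nonincreasing-take (suc (suc n)) {_ ∷ []} [-]          = [-]
nonincreasing-take (suc (suc n)) {_ ∷ _ ∷ _} (x≥y ∷ ni) = x≥y ∷ nonincreasing-take (suc n) ni

nonincreasing-drop : ∀ n {w} → Nonincreasing w → Nonincreasing (drop n w)
nonincreasing-drop zero            ni = ni
nonincreasing-drop (suc n) {[]}    ni = ni
nonincreasing-drop (suc n) {_ ∷ _} ni = nonincreasing-drop n (Linked.tail ni)

take-length-++ : ∀ (A B : List ℤ) → take (length A) (A ++ B) ≡ A
take-length-++ []      B = refl
take-length-++ (a ∷ A) B = cong (a ∷_) (take-length-++ A B)

drop-length-++ : ∀ (A B : List ℤ) → drop (length A) (A ++ B) ≡ B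
drop-length-++ []      B = refl
drop-length-++ (_ ∷ A) B = drop-length-++ A B

take-drop-≟ʷ : ∀ n w A B → length A ≡ n → ⌊ take n w ≟ʷ A ⌋ ∧ ⌊ drop n w ≟ʷ B ⌋ ≡ ⌊ w ≟ʷ A ++ B ⌋
take-drop-≟ʷ _ w A B refl with take (length A) w ≟ʷ A | drop (length A) w ≟ʷ B
... | yes t≡A | yes d≡B =
  sym (⌊⌋-true (w ≟ʷ A ++ B) (trans (sym (take++drop≡id (length A) w)) (cong₂ _++_ t≡A d≡B)))
... | yes _   | no d≢B  = sym (⌊⌋-false (w ≟ʷ A ++ B) (λ { refl → d≢B (drop-length-++ A B) }))
... | no t≢A  | _       = sym (⌊⌋-false (w ≟ʷ A ++ B) (λ { refl → t≢A (take-length-++ A B) }))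

-- Induction on the blocks

paths-length : ∀ y n → All (λ p → length (proj₁ p) ≡ n) (paths y n)
paths-length y zero    = refl ∷ []
paths-length y (suc n) = ++⁺ (map⁺ (All.map (cong suc) (paths-length y n)))
                             (map⁺ (All.map (cong suc) (paths-length (y - + 1) n)))

paths-head : ∀ y n → All (λ p → Any (_≤ y) (head (proj₁ p))) (paths y (suc n))
paths-head y n = ++⁺ (map⁺ (All.universal (λ _ → just ℤ.≤-refl) (paths y n)))
                     (map⁺ (All.universal (λ _ → just (ℤ.<⇒≤ (i-1<i y))) (paths (y - + 1) n)))

BC-head : ∀ M k rest → All (λ q → Any (_≤ M) (head (proj₁ q))) (BC ((M , suc k) ∷ rest))
BC-head M k rest = concat⁺ (map⁺ (filter⁺ _ (All.map prefix (paths-head M k))))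
  where
  prefix : ∀ {p} → Any (_≤ M) (head (proj₁ p)) →
    All (λ q → Any (_≤ M) (head (proj₁ q))) (map (λ q → (proj₁ p ++ proj₁ q , proj₂ p N.+ proj₂ q)) (BC rest))
  prefix {x ∷ _ , _} x≤M = map⁺ (All.universal (λ _ → x≤M) (BC rest))

lastAbove-head : ∀ {M} X Y → Any (_≤ M) (head Y) → T (lastAbove (just M) X) → T (lastAbove (head Y) X)
lastAbove-head X (_ ∷ _) (just y≤M) above = lastAbove-≤ X y≤M above

BC-below : ∀ X rest → Positive rest → T (lastAbove (nextLetter rest) X) →
  All (λ q → T (lastAbove (head (proj₁ q)) X)) (BC rest)
BC-below X []                   _         _     = tt ∷ []
BC-below X ((M , zero) ∷ rest)  (() ∷ _)  _
BC-below X ((M , suc k) ∷ rest) _         above =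
  All.map (λ {q} y≤M → lastAbove-head X (proj₁ q) y≤M above) (BC-head M k rest)

head-expand : ∀ rest → Positive rest → head (expand rest) ≡ nextLetter rest
head-expand []                  _        = refl
head-expand ((M , zero) ∷ rest) (() ∷ _)
head-expand ((M , suc k) ∷ rest) _       = refl

slidePrefixOK : List ℤ → List ℤ → List ℤ → Bool
slidePrefixOK X E w = (slideOK X u ∧ lastAbove (head v) u) ∧ ⌊ v ≟ʷ E ⌋
  where
  u = take (length X) w
  v = drop (length X) w

slidePrefixOK-length : ∀ n X E w → length X ≡ n →
  slidePrefixOK X E w ≡ slideOK X (take n w) ∧ (lastAbove (head (drop n w)) (take n w) ∧ ⌊ drop n w ≟ʷ E ⌋)
slidePrefixOK-length _ X E w refl = ∧-assoc (slideOK X (take (length X) w)) _ _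

slidePrefixOK⇒lastAbove : ∀ X E w → T (slidePrefixOK X E w) → T (lastAbove (head E) X)
slidePrefixOK⇒lastAbove X E w ok with ∧-T _ _ ok
... | covered , v≡E with ∧-T _ _ covered
...   | slid , descent =
  lastAbove-slideOK (head E) X u slid (subst (λ v → T (lastAbove (head v) u)) (toWitness v≡E) descent)
  where u = take (length X) w

descent-redundant : ∀ u v A B → T (lastAbove (head B) A) →
  (lastAbove (head v) u ∧ ⌊ v ≟ʷ B ⌋) ∧ ⌊ u ≟ʷ A ⌋ ≡ ⌊ u ≟ʷ A ⌋ ∧ ⌊ v ≟ʷ B ⌋
descent-redundant u v A B above with u ≟ʷ A | v ≟ʷ B
... | yes refl | yes refl rewrite Equivalence.to T-≡ above = refl
... | yes _    | no _     = cong (_∧ true) (∧-zeroʳ _)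
... | no _     | _        = ∧-zeroʳ _

lastAbove-expand : ∀ M k rest → Positive rest → Decreasing ((M , suc k) ∷ rest) →
  T (lastAbove (head (expand rest)) (replicate (suc k) M))
lastAbove-expand M k []                     _        _           = tt
lastAbove-expand M k ((M′ , zero) ∷ rest)   (() ∷ _) _
lastAbove-expand M k ((M′ , suc k′) ∷ rest) _        (M′<M ∷ _)  = lastAbove-replicate k M′<M

signedSum-slideOK-prefix : ∀ rest → Positive rest → SlideExpansion rest → ∀ X w → Nonincreasing w →
  T (lastAbove (nextLetter rest) X) →
  signedSum (BC rest) (λ Y → slideOK (X ++ Y) w) ≡ χ (slidePrefixOK X (expand rest) w)
signedSum-slideOK-prefix rest pos IH X w ni above = begin
    signedSum (BC rest) (λ Y → slideOK (X ++ Y) w)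
  ≡⟨ signedSum-congᴬ (All.map (λ {q} → slideOK-++ X (proj₁ q) w) (BC-below X rest pos above)) ⟩
    signedSum (BC rest) (λ Y → c ∧ slideOK Y v)
  ≡⟨ signedSum-guardˡ c (BC rest) (λ Y → slideOK Y v) ⟩
    onlyIf c (signedSum (BC rest) (λ Y → slideOK Y v))
  ≡⟨ cong (onlyIf c) (IH v (nonincreasing-drop (length X) ni)) ⟩
    onlyIf c (χ ⌊ v ≟ʷ expand rest ⌋)
  ≡⟨ sym (χ-∧ c ⌊ v ≟ʷ expand rest ⌋) ⟩
    χ (slidePrefixOK X (expand rest) w)
  ∎
  where
  u = take (length X) w
  v = drop (length X) w
  c = slideOK X u ∧ lastAbove (head v) u

slideExpansion-[] : SlideExpansion []
slideExpansion-[] w _ = trans (signedSum-singleton [] (λ D → slideOK D w)) (cong χ (slideOK-[] w))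

slideExpansion-∷ : ∀ M k rest → Positive rest → Decreasing ((M , suc k) ∷ rest) →
  SlideExpansion rest → SlideExpansion ((M , suc k) ∷ rest)
slideExpansion-∷ M k rest pos dec IH w ni = begin
    signedSum (BC ((M , n) ∷ rest)) (λ D → slideOK D w)
  ≡⟨ signedSum-BC-∷ M n rest _ (λ X → slidePrefixOK X E w)
       (All.map (λ {p} → signedSum-slideOK-prefix rest pos IH (proj₁ p) w ni) (all-filter _ (paths M n))) ⟩
    signedSum (blockB M n (nextLetter rest)) (λ X → slidePrefixOK X E w)
  ≡⟨ signedSum-filterᵇ (lastAbove (nextLetter rest)) (paths M n) _ ⟩
    signedSum (paths M n) (λ X → lastAbove (nextLetter rest) X ∧ slidePrefixOK X E w)
  ≡⟨ signedSum-congᴬ (All.map (λ {p} → absorb (proj₁ p)) (paths-length M n)) ⟩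
    signedSum (paths M n) (λ X → slideOK X u ∧ (j ∧ e))
  ≡⟨ signedSum-guardʳ (j ∧ e) (paths M n) (λ X → slideOK X u) ⟩
    onlyIf (j ∧ e) (signedSum (paths M n) (λ X → slideOK X u))
  ≡⟨ cong (onlyIf (j ∧ e)) (signedSum-slideOK-paths M n u (nonincreasing-take n ni)) ⟩
    onlyIf (j ∧ e) (χ ⌊ u ≟ʷ Mⁿ ⌋)
  ≡⟨ sym (χ-∧ (j ∧ e) ⌊ u ≟ʷ Mⁿ ⌋) ⟩
    χ ((j ∧ e) ∧ ⌊ u ≟ʷ Mⁿ ⌋)
  ≡⟨ cong χ (descent-redundant u v Mⁿ E (lastAbove-expand M k rest pos dec)) ⟩
    χ (⌊ u ≟ʷ Mⁿ ⌋ ∧ e)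
  ≡⟨ cong χ (take-drop-≟ʷ n w Mⁿ E (length-replicate n)) ⟩
    χ ⌊ w ≟ʷ Mⁿ ++ E ⌋
  ∎
  where
  n = suc k
  Mⁿ = replicate n M
  E = expand rest
  u = take n w
  v = drop n w
  j = lastAbove (head v) u
  e = ⌊ v ≟ʷ E ⌋
  absorb : ∀ X → length X ≡ n → lastAbove (nextLetter rest) X ∧ slidePrefixOK X E w ≡ slideOK X u ∧ (j ∧ e)
  absorb X len = trans
    (∧-absorbˡ _ _ λ ok →
      subst (λ m → T (lastAbove m X)) (head-expand rest pos) (slidePrefixOK⇒lastAbove X E w ok))
    (slidePrefixOK-length n X E w len)

slideExpansion : ∀ bs → Positive bs → Decreasing bs → SlideExpansion bs
slideExpansion []                 _          _   = slideExpansion-[]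
slideExpansion ((M , zero) ∷ bs)  (() ∷ _)   _
slideExpansion ((M , suc k) ∷ bs) (_ ∷ pos) dec =
  slideExpansion-∷ M k bs pos dec (slideExpansion bs pos (Linked.tail dec))

-- Both sides unfold definitionally to the two sides of SlideExpansion bs at w.
theorem5p2 : (C : List ℤ) → Nonincreasing C → C ≢ [] →
    (bs : List (ℤ × ℕ)) →
    All (λ b → 0 N.< proj₂ b) bs →
    Linked (λ a b → proj₁ a > proj₁ b) bs →
    C ≡ expand bs →
    monomialSeries C ≈ˢ signedSlideSum bs
theorem5p2 _ _ _ bs pos dec refl (w , ni) = sym (slideExpansion bs pos dec w ni)
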